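{- Let $T$ be a tree with $n\ge1$ vertices, let $\ell\ge n$ be an integer, and let $s$ be a self-reachable configuration on $T$ with $\ell$ chips. Then $s$ can be written as a convex combination of near-minimally self-reachable configurations on $T$ with $\ell$ chips.
   Context: Label the vertices $v_1,\dots,v_n$; $e_i$ is the $i$th standard basis vector. A chip configuration on $T$ is a vector $c\in\mathbb{Z}_{\ge0}^n$. The Laplacian $\Delta(T)$ has $\Delta_{ii}=\deg(v_i)$, $\Delta_{ij}=-1$ if $v_iv_j$ is an edge, $0$ otherwise; firing $v_i$ from $c$ produces $c-\Delta(T)e_i$, legal if $c_i\ge\deg(v_i)$. A configuration is self-reachable on $T$ if some nonempty finite sequence of legal firings starting from it returns to it. (Known: equivalently, it has at least $m-1$ chips on every $m$-vertex subtree.) It is minimally self-reachable if self-reachable with exactly $n-1$ chips. A configuration $\nu$ is near-minimally self-reachable if it is self-reachable and not minimally self-reachable, and there is a unique $i$ with $\nu-e_i$ self-reachable on $T$. -}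

module Defs where

open import Data.Nat using (ℕ; zero; suc; _+_; _*_; _∸_; _≤_; _<_)
open import Data.Fin using (Fin; toℕ; _≟_)
open import Data.Bool using (Bool; true; false; if_then_else_)
open import Data.Nat.ListAction using (sum)
open import Data.List using (List; []; _∷_; tabulate; length; filter; allFin; concatMap; map)
open import Data.Product using (Σ; ∃; _×_; _,_; proj₁; proj₂)
open import Data.Rational using (ℚ; 0ℚ; 1ℚ) renaming (_+_ to _+ℚ_; _*_ to _*ℚ_; _≤_ to _≤ℚ_)
open import Relation.Nullary using (¬_; does)
open import Relation.Binary.PropositionalEquality using (_≡_)
open import Data.Integer using (+_)
open import Relation.Binary.Construct.Closure.Transitive using (TransClosure)

Graph : ℕ → Set
Graph n = Fin n → Fin n → Bool

data Walk {n : ℕ} (G : Graph n) : Fin n → Fin n → Set where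
  here : ∀ {i} → Walk G i i
  step : ∀ {i j k} → G i j ≡ true → Walk G j k → Walk G i k

edgeCount : ∀ {n} → Graph n → ℕ
edgeCount {n} G =
  sum (concatMap (λ i → map (λ j → if (does (Data.Nat._<?_ (toℕ i) (toℕ j))) then (if G i j then 1 else 0) else 0) (allFin n)) (allFin n))

record IsTree {n : ℕ} (G : Graph n) : Set where
  field
    symmetric   : ∀ i j → G i j ≡ G j i
    irreflexive : ∀ i → G i i ≡ false
    connected   : ∀ i j → Walk G i j
    edges       : edgeCount G ≡ n ∸ 1

Config : ℕ → Set
Config n = Fin n → ℕ

deg : ∀ {n} → Graph n → Fin n → ℕ
deg {n} G i = sum (tabulate {n = n} (λ j → if G i j then 1 else 0))

chips : ∀ {n} → Config n → ℕ
chips {n} c = sum (tabulate {n = n} c)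

-- firing vertex i: c - Δ e_i (only applied when legal, c i ≥ deg i)
fire : ∀ {n} → Graph n → Config n → Fin n → Config n
fire G c i j with does (i ≟ j)
... | true  = c j ∸ deg G i
... | false = if G i j then suc (c j) else c j

Step : ∀ {n} → Graph n → Config n → Config n → Set
Step G c c' = Σ _ λ i → deg G i ≤ c i × (∀ j → c' j ≡ fire G c i j)

SelfReachable : ∀ {n} → Graph n → Config n → Set
SelfReachable G c = TransClosure (Step G) c c

MinSelfReachable : ∀ {n} → Graph n → Config n → Set
MinSelfReachable {n} G c = SelfReachable G c × chips c ≡ n ∸ 1

-- c - e_i  (used only when c i ≥ 1)
minusE : ∀ {n} → Config n → Fin n → Config n
minusE c i j with does (i ≟ j)
... | true  = c j ∸ 1
... | false = c j

-- ν - e_i is a configuration (nonnegative) and self-reachable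
MinusSR : ∀ {n} → Graph n → Config n → Fin n → Set
MinusSR G ν i = 1 ≤ ν i × SelfReachable G (minusE ν i)

NearMinSelfReachable : ∀ {n} → Graph n → Config n → Set
NearMinSelfReachable G ν =
  SelfReachable G ν × ¬ MinSelfReachable G ν ×
  Σ _ λ i → MinusSR G ν i × (∀ j → MinusSR G ν j → j ≡ i)

sumℚ : List ℚ → ℚ
sumℚ [] = 0ℚ
sumℚ (x ∷ xs) = x +ℚ sumℚ xs

data AllL {A : Set} (P : A → Set) : List A → Set where
  []  : AllL P []
  _∷_ : ∀ {x xs} → P x → AllL P xs → AllL P (x ∷ xs)

toℚ : ℕ → ℚ
toℚ k = Data.Rational._/_ (+ k) 1

ConvexCombinationOf : ∀ {n} → (Config n → Set) → Config n → Set
ConvexCombinationOf {n} P s =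
  Σ (List (ℚ × Config n)) λ terms →
    AllL (λ t → 0ℚ ≤ℚ proj₁ t × P (proj₂ t)) terms ×
    sumℚ (map proj₁ terms) ≡ 1ℚ ×
    (∀ v → toℚ (s v) ≡ sumℚ (map (λ t → proj₁ t *ℚ toℚ (proj₂ t v)) terms))

-- Call a labelling t : vertices → ℕ proper if it differs along every edge, and let outdeg t w count the
-- neighbours of w with a larger label. On a connected simple graph, c is self-reachable iff c ≥ outdeg t
-- for some proper t: firing every vertex once in increasing order of t is then legal (a vertex holds
-- c w ≥ outdeg t w chips plus one from each lower neighbour), and conversely the position of the last
-- firing of each vertex in a firing cycle is such a labelling. On a tree outdeg t has n - 1 chips, so
-- for k = ℓ - (n - 1) a self-reachable s with ℓ chips is the average of the configurations
-- ν t v = outdeg t + k·e_v weighted by s - outdeg t. If v is a local minimum of t, ν t v is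
-- near-minimal: ν t v - e_v still dominates outdeg t, whereas ν t v - e_j ≥ outdeg t' with j ≠ v would
-- give outdeg t' + e_j ≤ outdeg t, impossible since every outdeg vector has n - 1 chips. Otherwise,
-- relabelling v below everything (t*) gives (k + indeg t v)·ν t v = k·ν t* v + Σ ν t u over the
-- neighbours u of v with t u < t v, and induction on t v finishes.

{-# OPTIONS --safe #-}
module Submission where

open import Defs
open import Relation.Binary.Construct.Closure.Transitive as Closure using (TransClosure)
open import Data.Nat using (ℕ; zero; suc; _+_; _*_; _∸_; _≤_; _<_; z≤n; s≤s; _<ᵇ_)
open import Data.Nat.Properties hiding (_≟_)
open import Data.Nat.Tactic.RingSolver using (solve-∀)
open import Data.Nat.ListAction using () renaming (sum to sumList)
open import Data.Nat.ListAction.Properties using (sum-++; sum-↭)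
open import Data.Fin using (Fin; zero; suc; toℕ; _≟_)
open import Data.Fin.Properties using (toℕ-injective)
open import Data.Bool using (Bool; true; false; if_then_else_; _∨_)
open import Data.Bool.Properties using (∨-conicalˡ; ∨-conicalʳ)
open import Data.List using (List; []; _∷_; _++_; [_]; map; tabulate; allFin; concatMap)
open import Data.List.Properties using (map-++; map-tabulate; ++-identityʳ; ++-assoc)
open import Data.List.Relation.Unary.All as All using (All; []; _∷_)
open import Data.List.Relation.Unary.AllPairs using (AllPairs; _∷_)
open import Data.List.Relation.Unary.Linked.Properties using (Linked⇒AllPairs)
import Data.List.Sort as Sort
import Relation.Binary.Construct.On as On
import Induction.WellFounded as WF
open import Data.Nat.Induction using (<-wellFounded)
open import Data.List.Relation.Binary.Permutation.Propositional using (_↭_; ↭-sym)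
open import Data.List.Relation.Binary.Permutation.Propositional.Properties using (¬x∷xs↭[]) renaming (map⁺ to ↭-map⁺)
open import Data.Product using (Σ-syntax; _×_; _,_; proj₁; proj₂)
open import Relation.Nullary using (¬_; Dec; does; yes; no; contradiction)
open import Relation.Nullary.Reflects using (ofʸ; ofⁿ)
open import Relation.Nullary.Decidable using (dec-true; dec-false; decidable-stable)
open import Relation.Binary.PropositionalEquality using (_≡_; _≢_; refl; sym; trans; cong; cong₂; subst; module ≡-Reasoning)
import Data.Integer as ℤ
import Data.Integer.Properties as ℤ
open import Data.Rational as ℚ using (ℚ; mkℚ; toℚᵘ; 0ℚ; 1ℚ; 1/_)
import Data.Rational.Properties as ℚ
import Data.Rational.Unnormalised as ℚᵘ
import Data.Rational.Unnormalised.Properties as ℚᵘ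
open import Data.Nat.Coprimality using (1-coprimeTo) renaming (sym to coprime-sym)
open import Algebra.Bundles using (CommutativeRing)
import Algebra.Properties.Semiring.Sum as SemiringSum
open SemiringSum +-*-semiring using (sum; sum-cong-≗; ∑-distrib-+; ∑-comm; sum-replicate-zero; *-distribʳ-sum)
module ℚ∑ = SemiringSum (CommutativeRing.semiring ℚ.+-*-commutativeRing)

private variable
  A : Set
  n : ℕ
  G : Graph n

𝟙 : Bool → ℕ
𝟙 b = if b then 1 else 0

-- Finite sums

sum-tabulate : ∀ {n} (f : Fin n → ℕ) → sumList (tabulate f) ≡ sum f
sum-tabulate {zero} f = refl
sum-tabulate {suc n} f = cong (f zero +_) (sum-tabulate (λ i → f (suc i)))

sum-mono-≤ : ∀ {n} {f g : Fin n → ℕ} → (∀ i → f i ≤ g i) → sum f ≤ sum g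
sum-mono-≤ {zero} f≤g = z≤n
sum-mono-≤ {suc n} f≤g = +-mono-≤ (f≤g zero) (sum-mono-≤ (λ i → f≤g (suc i)))

term≤sum : ∀ {n} (f : Fin n → ℕ) (i : Fin n) → f i ≤ sum f
term≤sum f zero = m≤m+n _ _
term≤sum f (suc i) = ≤-trans (term≤sum (λ j → f (suc j)) i) (m≤n+m _ (f zero))

sum-single : ∀ {n} (f : Fin n → ℕ) (w : Fin n) → sum (λ u → if does (u ≟ w) then f u else 0) ≡ f w
sum-single {suc n} f zero = trans (cong (f zero +_) (sum-replicate-zero n)) (+-identityʳ _)
sum-single {suc n} f (suc w) = sum-single (λ u → f (suc u)) w

does-≟-comm : ∀ {n} (u w : Fin n) → does (u ≟ w) ≡ does (w ≟ u)
does-≟-comm u w with u ≟ w | w ≟ u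
... | yes _    | yes _   = refl
... | no _     | no _    = refl
... | yes refl | no w≢u  = contradiction refl w≢u
... | no u≢w   | yes refl = contradiction refl u≢w

m+m≡n+n⇒m≡n : ∀ {m n} → m + m ≡ n + n → m ≡ n
m+m≡n+n⇒m≡n {m} {n} eq = *-cancelˡ-≡ m n 2 (begin
  m + (m + 0)   ≡⟨ cong (m +_) (+-identityʳ m) ⟩
  m + m         ≡⟨ eq ⟩
  n + n         ≡⟨ cong (n +_) (+-identityʳ n) ⟨
  n + (n + 0)   ∎)
  where open ≡-Reasoning

∑∑-symmetrisation : ∀ {n} (f g : Fin n → Fin n → ℕ) → (∀ i j → f i j + f j i ≡ g i j + g j i) →
  sum (λ i → sum (f i)) ≡ sum (λ i → sum (g i))
∑∑-symmetrisation f g eq = m+m≡n+n⇒m≡n (begin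
  ∑∑ f + ∑∑ f                                   ≡⟨ cong (∑∑ f +_) (∑-comm f) ⟩
  ∑∑ f + sum (λ i → sum (λ j → f j i))          ≡⟨ ∑-distrib-+ (λ i → sum (f i)) _ ⟨
  sum (λ i → sum (f i) + sum (λ j → f j i))     ≡⟨ sum-cong-≗ (λ i → ∑-distrib-+ (f i) (λ j → f j i)) ⟨
  sum (λ i → sum (λ j → f i j + f j i))         ≡⟨ sum-cong-≗ (λ i → sum-cong-≗ (eq i)) ⟩
  sum (λ i → sum (λ j → g i j + g j i))         ≡⟨ sum-cong-≗ (λ i → ∑-distrib-+ (g i) (λ j → g j i)) ⟩
  sum (λ i → sum (g i) + sum (λ j → g j i))     ≡⟨ ∑-distrib-+ (λ i → sum (g i)) _ ⟩
  ∑∑ g + sum (λ i → sum (λ j → g j i))          ≡⟨ cong (∑∑ g +_) (∑-comm g) ⟨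
  ∑∑ g + ∑∑ g                                   ∎)
  where
  open ≡-Reasoning
  ∑∑ : (Fin _ → Fin _ → ℕ) → ℕ
  ∑∑ h = sum (λ i → sum (h i))

sum-map-++ : ∀ (f : A → ℕ) xs ys → sumList (map f (xs ++ ys)) ≡ sumList (map f xs) + sumList (map f ys)
sum-map-++ f xs ys = trans (cong sumList (map-++ f xs ys)) (sum-++ (map f xs) (map f ys))

sum-map-∷ʳ : ∀ (f : A → ℕ) xs x → sumList (map f (xs ++ [ x ])) ≡ sumList (map f xs) + f x
sum-map-∷ʳ f xs x = trans (sum-map-++ f xs [ x ]) (cong (sumList (map f xs) +_) (+-identityʳ (f x)))

sum-map-mono-≤ : ∀ {f g : A → ℕ} xs → (∀ x → f x ≤ g x) → sumList (map f xs) ≤ sumList (map g xs)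
sum-map-mono-≤ [] f≤g = z≤n
sum-map-mono-≤ (x ∷ xs) f≤g = +-mono-≤ (f≤g x) (sum-map-mono-≤ xs f≤g)

sum-map-zero : ∀ {f : A → ℕ} {xs} → All (λ x → f x ≡ 0) xs → sumList (map f xs) ≡ 0
sum-map-zero [] = refl
sum-map-zero (fx≡0 ∷ fxs≡0) = cong₂ _+_ fx≡0 (sum-map-zero fxs≡0)

sum-map-↭ : ∀ (f : A → ℕ) {xs ys} → xs ↭ ys → sumList (map f xs) ≡ sumList (map f ys)
sum-map-↭ f xs↭ys = sum-↭ (↭-map⁺ f xs↭ys)

sum-map-allFin : ∀ (f : Fin n → ℕ) → sumList (map f (allFin n)) ≡ sum f
sum-map-allFin f = trans (cong sumList (map-tabulate (λ i → i) f)) (sum-tabulate f)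

sum-concatMap-allFin : ∀ (f : Fin n → Fin n → ℕ) →
  sumList (concatMap (λ i → map (f i) (allFin n)) (allFin n)) ≡ sum (λ i → sum (f i))
sum-concatMap-allFin {n} f = begin
  sumList (concatMap row (allFin n))           ≡⟨ rows (allFin n) ⟩
  sumList (map (λ i → sumList (row i)) (allFin n)) ≡⟨ sum-map-allFin (λ i → sumList (row i)) ⟩
  sum (λ i → sumList (row i))                  ≡⟨ sum-cong-≗ (λ i → sum-map-allFin (f i)) ⟩
  sum (λ i → sum (f i))                        ∎
  where
  open ≡-Reasoning
  row : Fin n → List ℕ
  row i = map (f i) (allFin n)
  rows : ∀ is → sumList (concatMap row is) ≡ sumList (map (λ i → sumList (row i)) is)
  rows []       = refl
  rows (i ∷ is) = trans (sum-++ (row i) _) (cong (sumList (row i) +_) (rows is))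

chips≡sum : ∀ (c : Config n) → chips c ≡ sum c
chips≡sum = sum-tabulate

-- Convex combinations

toℚ≡mkℚ : ∀ k → toℚ k ≡ mkℚ (ℤ.+ k) 0 (coprime-sym (1-coprimeTo k))
toℚ≡mkℚ k = ℚ.normalize-coprime _

toℚᵘ-toℚ : ∀ k → toℚᵘ (toℚ k) ℚᵘ.≃ ℚᵘ.mkℚᵘ (ℤ.+ k) 0
toℚᵘ-toℚ k rewrite toℚ≡mkℚ k = ℚᵘ.≃-refl

toℚ-+ : ∀ a b → toℚ (a + b) ≡ toℚ a ℚ.+ toℚ b
toℚ-+ a b = ℚ.toℚᵘ-injective (begin
  toℚᵘ (toℚ (a + b))                          ≈⟨ toℚᵘ-toℚ (a + b) ⟩
  ℚᵘ.mkℚᵘ (ℤ.+ (a + b)) 0                     ≈⟨ ℚᵘ.*≡* (cong (ℤ._* ℤ.1ℤ) numerators) ⟩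
  ℚᵘ.mkℚᵘ (ℤ.+ a) 0 ℚᵘ.+ ℚᵘ.mkℚᵘ (ℤ.+ b) 0    ≈⟨ ℚᵘ.+-cong (toℚᵘ-toℚ a) (toℚᵘ-toℚ b) ⟨
  toℚᵘ (toℚ a) ℚᵘ.+ toℚᵘ (toℚ b)              ≈⟨ ℚ.toℚᵘ-homo-+ (toℚ a) (toℚ b) ⟨
  toℚᵘ (toℚ a ℚ.+ toℚ b)                      ∎)
  where
  open ℚᵘ.≃-Reasoning
  numerators : ℤ.+ (a + b) ≡ ℤ.+ a ℤ.* ℤ.1ℤ ℤ.+ ℤ.+ b ℤ.* ℤ.1ℤ
  numerators = trans (ℤ.pos-+ a b) (sym (cong₂ ℤ._+_ (ℤ.*-identityʳ (ℤ.+ a)) (ℤ.*-identityʳ (ℤ.+ b))))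

toℚ-* : ∀ a b → toℚ (a * b) ≡ toℚ a ℚ.* toℚ b
toℚ-* a b = ℚ.toℚᵘ-injective (begin
  toℚᵘ (toℚ (a * b))                          ≈⟨ toℚᵘ-toℚ (a * b) ⟩
  ℚᵘ.mkℚᵘ (ℤ.+ (a * b)) 0                     ≈⟨ ℚᵘ.*≡* (cong (ℤ._* ℤ.1ℤ) (ℤ.pos-* a b)) ⟩
  ℚᵘ.mkℚᵘ (ℤ.+ a) 0 ℚᵘ.* ℚᵘ.mkℚᵘ (ℤ.+ b) 0    ≈⟨ ℚᵘ.*-cong (toℚᵘ-toℚ a) (toℚᵘ-toℚ b) ⟨
  toℚᵘ (toℚ a) ℚᵘ.* toℚᵘ (toℚ b)              ≈⟨ ℚ.toℚᵘ-homo-* (toℚ a) (toℚ b) ⟨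
  toℚᵘ (toℚ a ℚ.* toℚ b)                      ∎)
  where open ℚᵘ.≃-Reasoning

toℚ-sum : ∀ {N} (f : Fin N → ℕ) → toℚ (sum f) ≡ ℚ∑.sum (λ a → toℚ (f a))
toℚ-sum {zero} f = refl
toℚ-sum {suc N} f = trans (toℚ-+ (f zero) _) (cong (toℚ (f zero) ℚ.+_) (toℚ-sum (λ a → f (suc a))))

0≤toℚ : ∀ k → 0ℚ ℚ.≤ toℚ k
0≤toℚ k rewrite toℚ≡mkℚ k = ℚ.nonNegative⁻¹ _

0≤*0≤⇒0≤ : ∀ {p q} → 0ℚ ℚ.≤ p → 0ℚ ℚ.≤ q → 0ℚ ℚ.≤ p ℚ.* q
0≤*0≤⇒0≤ {p} {q} 0≤p 0≤q =
  ℚ.nonNegative⁻¹ (p ℚ.* q) {{ℚ.nonNeg*nonNeg⇒nonNeg p {{ℚ.nonNegative 0≤p}} q {{ℚ.nonNegative 0≤q}}}}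

toℚ-positive : ∀ j → ℚ.Positive (toℚ (suc j))
toℚ-positive j = subst ℚ.Positive (sym (toℚ≡mkℚ (suc j))) _

sumℚ-++ : ∀ xs ys → sumℚ (xs ++ ys) ≡ sumℚ xs ℚ.+ sumℚ ys
sumℚ-++ [] ys = sym (ℚ.+-identityˡ _)
sumℚ-++ (x ∷ xs) ys = trans (cong (x ℚ.+_) (sumℚ-++ xs ys)) (sym (ℚ.+-assoc x _ _))

sumℚ-map-++ : ∀ (f : A → ℚ) xs ys → sumℚ (map f (xs ++ ys)) ≡ sumℚ (map f xs) ℚ.+ sumℚ (map f ys)
sumℚ-map-++ f xs ys = trans (cong sumℚ (map-++ f xs ys)) (sumℚ-++ (map f xs) (map f ys))

AllL-++ : ∀ {P : A → Set} {xs ys} → AllL P xs → AllL P ys → AllL P (xs ++ ys)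
AllL-++ [] pys = pys
AllL-++ (px ∷ pxs) pys = px ∷ AllL-++ pxs pys

module _ {n : ℕ} (P : Config n → Set) where

  Admissible : ℚ × Config n → Set
  Admissible t = 0ℚ ℚ.≤ proj₁ t × P (proj₂ t)

  weight : List (ℚ × Config n) → ℚ
  weight L = sumℚ (map proj₁ L)

  moment : List (ℚ × Config n) → Fin n → ℚ
  moment L v = sumℚ (map (λ t → proj₁ t ℚ.* toℚ (proj₂ t v)) L)

  ConicCombination : ℚ → (Fin n → ℚ) → Set
  ConicCombination w p =
    Σ[ L ∈ List (ℚ × Config n) ] AllL Admissible L × weight L ≡ w × (∀ v → moment L v ≡ p v)

  conic-cong : ∀ {w w' p p'} → w ≡ w' → (∀ v → p v ≡ p' v) →
               ConicCombination w p → ConicCombination w' p'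
  conic-cong w≡w' p≗p' (L , adm , wL , mL) = L , adm , trans wL w≡w' , λ v → trans (mL v) (p≗p' v)

  conic-zero : ConicCombination 0ℚ (λ _ → 0ℚ)
  conic-zero = [] , [] , refl , λ _ → refl

  conic-+ : ∀ {w w' p p'} → ConicCombination w p → ConicCombination w' p' →
            ConicCombination (w ℚ.+ w') (λ v → p v ℚ.+ p' v)
  conic-+ (L , adm , wL , mL) (L' , adm' , wL' , mL') =
    L ++ L' , AllL-++ adm adm' ,
    trans (sumℚ-map-++ proj₁ L L') (cong₂ ℚ._+_ wL wL') ,
    λ v → trans (sumℚ-map-++ _ L L') (cong₂ ℚ._+_ (mL v) (mL' v))

  conic-scale : ∀ {c w p} → 0ℚ ℚ.≤ c → ConicCombination w p →
                ConicCombination (c ℚ.* w) (λ v → c ℚ.* p v)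
  conic-scale {c} 0≤c (L , adm , wL , mL) =
    scale L , scale-admissible adm , trans (weight-scale L) (cong (c ℚ.*_) wL) ,
    λ v → trans (moment-scale L v) (cong (c ℚ.*_) (mL v))
    where
    scale : List (ℚ × Config n) → List (ℚ × Config n)
    scale = map (λ t → c ℚ.* proj₁ t , proj₂ t)
    scale-admissible : ∀ {L} → AllL Admissible L → AllL Admissible (scale L)
    scale-admissible [] = []
    scale-admissible ((0≤q , px) ∷ adm) = (0≤*0≤⇒0≤ 0≤c 0≤q , px) ∷ scale-admissible adm
    weight-scale : ∀ L → weight (scale L) ≡ c ℚ.* weight L
    weight-scale [] = sym (ℚ.*-zeroʳ c)
    weight-scale (t ∷ L) =
      trans (cong (c ℚ.* proj₁ t ℚ.+_) (weight-scale L)) (sym (ℚ.*-distribˡ-+ c _ _))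
    moment-scale : ∀ L v → moment (scale L) v ≡ c ℚ.* moment L v
    moment-scale [] v = sym (ℚ.*-zeroʳ c)
    moment-scale (t ∷ L) v =
      trans (cong₂ ℚ._+_ (ℚ.*-assoc c (proj₁ t) _) (moment-scale L v)) (sym (ℚ.*-distribˡ-+ c _ _))

  conic-sum : ∀ {N} {w : Fin N → ℚ} {p : Fin N → Fin n → ℚ} → (∀ a → ConicCombination (w a) (p a)) →
              ConicCombination (ℚ∑.sum w) (λ v → ℚ∑.sum (λ a → p a v))
  conic-sum {zero} _ = conic-zero
  conic-sum {suc N} h = conic-+ (h zero) (conic-sum (λ a → h (suc a)))

  conic-multiple : ∀ j {x} → (0 < j → ConvexCombinationOf P x) →
                   ConicCombination (toℚ j) (λ v → toℚ (j * x v))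
  conic-multiple zero _ = conic-zero
  conic-multiple (suc j) {x} convex with convex (s≤s z≤n)
  ... | L , adm , wL , xL =
    conic-cong (ℚ.*-identityʳ _) (λ v → sym (toℚ-* (suc j) (x v)))
      (conic-scale (0≤toℚ (suc j)) (L , adm , wL , λ v → sym (xL v)))

  conic⇒convex : ∀ {s} → ConicCombination 1ℚ (λ v → toℚ (s v)) → ConvexCombinationOf P s
  conic⇒convex (L , adm , wL , mL) = L , adm , wL , λ v → sym (mL v)

  convex-single : ∀ {x} → P x → ConvexCombinationOf P x
  convex-single {x} px =
    (1ℚ , x) ∷ [] , (ℚ.nonNegative⁻¹ 1ℚ , px) ∷ [] , ℚ.+-identityʳ 1ℚ ,
    λ v → sym (trans (ℚ.+-identityʳ _) (ℚ.*-identityˡ _))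

  conic-normalise : ∀ {M s} → 0 < M → ConicCombination (toℚ M) (λ v → toℚ (M * s v)) →
                    ConvexCombinationOf P s
  conic-normalise {suc j} {s} (s≤s z≤n) conic =
    conic⇒convex {s} (conic-cong (ℚ.*-inverseˡ M) cancel (conic-scale 0≤M⁻¹ conic))
    where
    M = toℚ (suc j)
    instance
      M>0 : ℚ.Positive M
      M>0 = toℚ-positive j
      M≢0 : ℚ.NonZero M
      M≢0 = ℚ.pos⇒nonZero M
    M⁻¹ = 1/ M
    0≤M⁻¹ : 0ℚ ℚ.≤ M⁻¹
    0≤M⁻¹ = ℚ.nonNegative⁻¹ M⁻¹ {{ℚ.pos⇒nonNeg M⁻¹ {{ℚ.1/pos⇒pos M}}}}
    cancel : ∀ v → M⁻¹ ℚ.* toℚ (suc j * s v) ≡ toℚ (s v)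
    cancel v = begin
      M⁻¹ ℚ.* toℚ (suc j * s v)     ≡⟨ cong (M⁻¹ ℚ.*_) (toℚ-* (suc j) (s v)) ⟩
      M⁻¹ ℚ.* (M ℚ.* toℚ (s v))     ≡⟨ ℚ.*-assoc M⁻¹ M _ ⟨
      (M⁻¹ ℚ.* M) ℚ.* toℚ (s v)     ≡⟨ cong (ℚ._* toℚ (s v)) (ℚ.*-inverseˡ M) ⟩
      1ℚ ℚ.* toℚ (s v)              ≡⟨ ℚ.*-identityˡ _ ⟩
      toℚ (s v)                     ∎
      where open ≡-Reasoning

  convex-average : ∀ {N} (m : Fin N → ℕ) (x : Fin N → Config n) {s : Config n} →
    (∀ a → 0 < m a → ConvexCombinationOf P (x a)) → 0 < sum m →
    (∀ v → sum m * s v ≡ sum (λ a → m a * x a v)) → ConvexCombinationOf P s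
  convex-average m x {s} convex sum>0 s-avg =
    conic-normalise {sum m} {s} sum>0 (conic-cong (sym (toℚ-sum m)) moments
      (conic-sum (λ a → conic-multiple (m a) (convex a))))
    where
    moments : ∀ v → ℚ∑.sum (λ a → toℚ (m a * x a v)) ≡ toℚ (sum m * s v)
    moments v = trans (sym (toℚ-sum (λ a → m a * x a v))) (cong toℚ (sym (s-avg v)))

-- Orientations induced by labellings

deg≡sum : ∀ (G : Graph n) w → deg G w ≡ sum (λ u → 𝟙 (G w u))
deg≡sum G w = sum-tabulate (λ u → 𝟙 (G w u))

Symmetric : Graph n → Set
Symmetric G = ∀ u w → G u w ≡ G w u

Loopless : Graph n → Set
Loopless G = ∀ u → G u u ≡ false

arc : Graph n → (Fin n → ℕ) → Fin n → Fin n → ℕ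
arc G t u w = if t u <ᵇ t w then 𝟙 (G u w) else 0

outdeg : Graph n → (Fin n → ℕ) → Config n
outdeg G t w = sum (arc G t w)

indeg : Graph n → (Fin n → ℕ) → Config n
indeg G t w = sum (λ u → arc G t u w)

Proper : Graph n → (Fin n → ℕ) → Set
Proper G t = ∀ u w → G u w ≡ true → t u ≢ t w

IsLocalMin : Graph n → (Fin n → ℕ) → Fin n → Set
IsLocalMin G t v = ∀ u → G v u ≡ true → t v < t u

OutDominated : Graph n → Config n → Set
OutDominated {n} G c = Σ[ t ∈ (Fin n → ℕ) ] Proper G t × (∀ w → outdeg G t w ≤ c w)

arc≤𝟙 : ∀ t u w → arc G t u w ≤ 𝟙 (G u w)
arc≤𝟙 t u w with t u <ᵇ t w
... | true  = ≤-refl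
... | false = z≤n

arc-symmetrisation : Symmetric G → ∀ {t} → Proper G t → ∀ u w → arc G t u w + arc G t w u ≡ 𝟙 (G u w)
arc-symmetrisation {G = G} symmetric {t} proper u w
  with t u <ᵇ t w | <ᵇ-reflects-< (t u) (t w) | t w <ᵇ t u | <ᵇ-reflects-< (t w) (t u)
... | true  | ofʸ u<w  | true  | ofʸ w<u  = contradiction w<u (<-asym u<w)
... | true  | _        | false | _        = +-identityʳ _
... | false | _        | true  | _        = cong 𝟙 (symmetric w u)
... | false | ofⁿ u≮w  | false | ofⁿ w≮u with G u w in uw
...   | false = refl
...   | true  = contradiction (≤-antisym (≮⇒≥ w≮u) (≮⇒≥ u≮w)) (proper u w uw)

deg≡outdeg+indeg : Symmetric G → ∀ {t} → Proper G t → ∀ w → deg G w ≡ outdeg G t w + indeg G t w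
deg≡outdeg+indeg {G = G} symmetric {t} proper w = begin
  deg G w                                       ≡⟨ deg≡sum G w ⟩
  sum (λ u → 𝟙 (G w u))                         ≡⟨ sum-cong-≗ (arc-symmetrisation {G = G} symmetric proper w) ⟨
  sum (λ u → arc G t w u + arc G t u w)         ≡⟨ ∑-distrib-+ (arc G t w) (λ u → arc G t u w) ⟩
  outdeg G t w + indeg G t w                    ∎
  where open ≡-Reasoning

outdeg≤deg : ∀ t w → outdeg G t w ≤ deg G w
outdeg≤deg {G = G} t w = ≤-trans (sum-mono-≤ (arc≤𝟙 {G = G} t w)) (≤-reflexive (sym (deg≡sum G w)))

outdeg-localMin : ∀ {t v} → IsLocalMin G t v → outdeg G t v ≡ deg G v
outdeg-localMin {G = G} {t} {v} min = trans (sum-cong-≗ arc≡𝟙) (sym (deg≡sum G v))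
  where
  arc≡𝟙 : ∀ u → arc G t v u ≡ 𝟙 (G v u)
  arc≡𝟙 u with t v <ᵇ t u | <ᵇ-reflects-< (t v) (t u)
  ... | true  | _        = refl
  ... | false | ofⁿ v≮u with G v u in vu
  ...   | false = refl
  ...   | true  = contradiction (min u vu) v≮u

sum-outdeg-independent : Symmetric G → ∀ {t t'} → Proper G t → Proper G t' →
                         sum (outdeg G t) ≡ sum (outdeg G t')
sum-outdeg-independent symmetric proper proper' = ∑∑-symmetrisation _ _ (λ u w →
  trans (arc-symmetrisation symmetric proper u w) (sym (arc-symmetrisation symmetric proper' u w)))

toℕ-proper : Loopless G → Proper G toℕ
toℕ-proper {G = G} loopless u w uw u≡w with toℕ-injective u≡w
... | refl = contradiction (trans (sym uw) (loopless u)) λ ()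

-- edgeCount counts each edge from its endpoint of smaller index, i.e. it is the out-degree sum for toℕ.
sum-outdeg-tree : ∀ {n} {G : Graph n} → IsTree G → ∀ {t} → Proper G t → sum (outdeg G t) ≡ n ∸ 1
sum-outdeg-tree {n} {G} tree {t} proper = begin
  sum (outdeg G t)      ≡⟨ sum-outdeg-independent symmetric proper (toℕ-proper irreflexive) ⟩
  sum (outdeg G toℕ)    ≡⟨ sum-concatMap-allFin (arc G toℕ) ⟨
  edgeCount G           ≡⟨ edges ⟩
  n ∸ 1                 ∎
  where
  open IsTree tree
  open ≡-Reasoning

arc-self : Loopless G → ∀ t v → arc G t v v ≡ 0
arc-self {G = G} loopless t v rewrite loopless v with t v <ᵇ t v
... | true  = refl
... | false = refl

arc>0⇒< : ∀ t {u v} → 0 < arc G t u v → t u < t v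
arc>0⇒< t {u} {v} arc>0 with t u <ᵇ t v | <ᵇ-reflects-< (t u) (t v)
... | true  | ofʸ u<v = u<v
... | false | _       = contradiction arc>0 λ ()

lower : (Fin n → ℕ) → Fin n → Fin n → ℕ
lower t v w = if does (w ≟ v) then 0 else suc (t w)

lower-proper : Loopless G → ∀ {t} → Proper G t → ∀ v → Proper G (lower t v)
lower-proper {G = G} loopless proper v u w uw with u ≟ v | w ≟ v
... | yes refl | yes refl = λ _ → contradiction (trans (sym uw) (loopless u)) λ ()
... | yes refl | no _     = λ ()
... | no _     | yes refl = λ ()
... | no _     | no _     = λ same → proper u w uw (suc-injective same)

lower-localMin : Loopless G → ∀ t v → IsLocalMin G (lower t v) v
lower-localMin loopless t v u vu rewrite dec-true (v ≟ v) refl with u ≟ v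
... | yes refl = contradiction (trans (sym vu) (loopless v)) λ ()
... | no _     = s≤s z≤n

outdeg-lower-other : ∀ t {v w} → w ≢ v → outdeg G t w ≡ outdeg G (lower t v) w + arc G t w v
outdeg-lower-other {G = G} t {v} {w} w≢v = begin
  sum (arc G t w)                                                     ≡⟨ sum-cong-≗ split ⟩
  sum (λ u → arc G (lower t v) w u + (if does (u ≟ v) then arc G t w u else 0))
                                                                      ≡⟨ ∑-distrib-+ (arc G (lower t v) w) _ ⟩
  outdeg G (lower t v) w + sum (λ u → if does (u ≟ v) then arc G t w u else 0)
                                                                      ≡⟨ cong (outdeg G (lower t v) w +_) (sum-single (arc G t w) v) ⟩
  outdeg G (lower t v) w + arc G t w v                                ∎
  where
  open ≡-Reasoning
  split : ∀ u → arc G t w u ≡ arc G (lower t v) w u + (if does (u ≟ v) then arc G t w u else 0)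
  split u rewrite dec-false (w ≟ v) w≢v with u ≟ v
  ... | yes refl = refl
  ... | no _     = sym (+-identityʳ _)

-- Firing sequences

data LegalRun (G : Graph n) : Config n → List (Fin n) → Config n → Set where
  done  : ∀ {d d'} → (∀ j → d' j ≡ d j) → LegalRun G d [] d'
  fires : ∀ {d d₁ d' L} u → deg G u ≤ d u → (∀ j → d₁ j ≡ fire G d u j) → LegalRun G d₁ L d' →
          LegalRun G d (u ∷ L) d'

run⇒closure : ∀ {d d' u L} → LegalRun G d (u ∷ L) d' → TransClosure (Step G) d d'
run⇒closure (fires u legal d₁≗ (done d'≗d₁)) = Closure.[ u , legal , (λ j → trans (d'≗d₁ j) (d₁≗ j)) ]
run⇒closure (fires u legal d₁≗ run@(fires _ _ _ _)) = (u , legal , d₁≗) Closure.∷ run⇒closure run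

closure⇒run : ∀ {d d'} → TransClosure (Step G) d d' →
              Σ[ u ∈ Fin _ ] Σ[ L ∈ List (Fin _) ] LegalRun G d (u ∷ L) d'
closure⇒run Closure.[ u , legal , d'≗ ] = u , [] , fires u legal d'≗ (done (λ _ → refl))
closure⇒run ((u , legal , d₁≗) Closure.∷ steps) with closure⇒run steps
... | u₁ , L , run = u , u₁ ∷ L , fires u legal d₁≗ run

fire-self : ∀ (G : Graph n) d q → fire G d q q ≡ d q ∸ deg G q
fire-self G d q rewrite dec-true (q ≟ q) refl = refl

fire-other : ∀ (G : Graph n) d {q w} → q ≢ w → fire G d q w ≡ d w + 𝟙 (G q w)
fire-other G d {q} {w} q≢w rewrite dec-false (q ≟ w) q≢w with G q w
... | true  = +-comm 1 (d w)
... | false = sym (+-identityʳ (d w))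

count : List (Fin n) → Fin n → ℕ
count L w = sumList (map (λ u → 𝟙 (does (u ≟ w))) L)

received : Graph n → List (Fin n) → Fin n → ℕ
received G L w = sumList (map (λ u → 𝟙 (G u w)) L)

-- d = c - Δ(G)·(multiplicities of L), with the subtracted term moved to the left.
FiredFrom : Graph n → Config n → List (Fin n) → Config n → Set
FiredFrom G c L d = ∀ w → d w + count L w * deg G w ≡ c w + received G L w

count-∷ʳ : ∀ L (q w : Fin n) → count (L ++ [ q ]) w ≡ count L w + 𝟙 (does (q ≟ w))
count-∷ʳ L q w = sum-map-∷ʳ (λ u → 𝟙 (does (u ≟ w))) L q

received-∷ʳ : ∀ (G : Graph n) L q w → received G (L ++ [ q ]) w ≡ received G L w + 𝟙 (G q w)
received-∷ʳ G L q w = sum-map-∷ʳ (λ u → 𝟙 (G u w)) L q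

firedFrom-∷ʳ : Loopless G → ∀ {c L d q} → FiredFrom G c L d → deg G q ≤ d q →
               FiredFrom G c (L ++ [ q ]) (fire G d q)
firedFrom-∷ʳ {G = G} loopless {c} {L} {d} {q} inv legal w = by-cases (q ≟ w)
  where
  open ≡-Reasoning
  D = deg G w
  shift-self : ∀ a x D → a + (x + 1) * D ≡ (a + D) + x * D
  shift-self = solve-∀
  shift-other : ∀ a b x D → (a + b) + (x + 0) * D ≡ (a + x * D) + b
  shift-other = solve-∀
  by-cases : Dec (q ≡ w) → fire G d q w + count (L ++ [ q ]) w * D ≡ c w + received G (L ++ [ q ]) w
  by-cases (yes refl) = begin
    fire G d q q + count (L ++ [ q ]) q * D   ≡⟨ cong₂ (λ x y → x + y * D) (fire-self G d q) count-q ⟩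
    (d q ∸ D) + (count L q + 1) * D          ≡⟨ shift-self (d q ∸ D) (count L q) D ⟩
    ((d q ∸ D) + D) + count L q * D          ≡⟨ cong (_+ count L q * D) (m∸n+n≡m legal) ⟩
    d q + count L q * D                      ≡⟨ inv q ⟩
    c q + received G L q                     ≡⟨ cong (c q +_) received-q ⟨
    c q + received G (L ++ [ q ]) q          ∎
    where
    count-q : count (L ++ [ q ]) q ≡ count L q + 1
    count-q = trans (count-∷ʳ L q q) (cong (λ b → count L q + 𝟙 b) (dec-true (q ≟ q) refl))
    received-q : received G (L ++ [ q ]) q ≡ received G L q
    received-q = trans (received-∷ʳ G L q q)
                       (trans (cong (λ b → received G L q + 𝟙 b) (loopless q)) (+-identityʳ _))
  by-cases (no q≢w) = begin
    fire G d q w + count (L ++ [ q ]) w * D   ≡⟨ cong₂ (λ x y → x + y * D) (fire-other G d q≢w) count-w ⟩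
    (d w + 𝟙 (G q w)) + (count L w + 0) * D  ≡⟨ shift-other (d w) (𝟙 (G q w)) (count L w) D ⟩
    (d w + count L w * D) + 𝟙 (G q w)        ≡⟨ cong (_+ 𝟙 (G q w)) (inv w) ⟩
    (c w + received G L w) + 𝟙 (G q w)       ≡⟨ +-assoc (c w) _ _ ⟩
    c w + (received G L w + 𝟙 (G q w))       ≡⟨ cong (c w +_) (received-∷ʳ G L q w) ⟨
    c w + received G (L ++ [ q ]) w          ∎
    where
    count-w : count (L ++ [ q ]) w ≡ count L w + 0
    count-w = trans (count-∷ʳ L q w) (cong (λ b → count L w + 𝟙 b) (dec-false (q ≟ w) q≢w))

firedFrom-legal : Symmetric G → ∀ {t c L d q} → Proper G t → FiredFrom G c L d → count L q ≡ 0 →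
                  outdeg G t q ≤ c q → indeg G t q ≤ received G L q → deg G q ≤ d q
firedFrom-legal {G = G} symmetric {t} {c} {L} {d} {q} proper inv unfired out≤c in≤received = begin
  deg G q                        ≡⟨ deg≡outdeg+indeg symmetric proper q ⟩
  outdeg G t q + indeg G t q     ≤⟨ +-mono-≤ out≤c in≤received ⟩
  c q + received G L q           ≡⟨ inv q ⟨
  d q + count L q * deg G q      ≡⟨ cong (λ x → d q + x * deg G q) unfired ⟩
  d q + 0                        ≡⟨ +-identityʳ (d q) ⟩
  d q                            ∎
  where open ≤-Reasoning

firedFrom-allFin : Symmetric G → ∀ {c L d} → FiredFrom G c L d → L ↭ allFin n → ∀ j → d j ≡ c j
firedFrom-allFin {G = G} symmetric {c} {L} {d} inv L↭ j = +-cancelʳ-≡ (deg G j) (d j) (c j) (begin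
  d j + deg G j                   ≡⟨ cong (d j +_) (*-identityˡ (deg G j)) ⟨
  d j + 1 * deg G j               ≡⟨ cong (λ x → d j + x * deg G j) once ⟨
  d j + count L j * deg G j       ≡⟨ inv j ⟩
  c j + received G L j            ≡⟨ cong (c j +_) all-neighbours ⟩
  c j + deg G j                   ∎)
  where
  open ≡-Reasoning
  once : count L j ≡ 1
  once = trans (sum-map-↭ _ L↭) (trans (sum-map-allFin (λ u → 𝟙 (does (u ≟ j)))) (sum-single (λ _ → 1) j))
  all-neighbours : received G L j ≡ deg G j
  all-neighbours = trans (sum-map-↭ _ L↭) (trans (sum-map-allFin (λ u → 𝟙 (G u j)))
    (trans (sum-cong-≗ {x = λ u → 𝟙 (G u j)} (λ u → cong 𝟙 (symmetric u j))) (sym (deg≡sum G j))))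

module _ {n} {G : Graph n} (symmetric : Symmetric G) (loopless : Loopless G)
         {t : Fin n → ℕ} (proper : Proper G t) {c : Config n} (out≤c : ∀ w → outdeg G t w ≤ c w) where

  private
    unfired : ∀ P q Q → P ++ q ∷ Q ↭ allFin n → count P q ≡ 0
    unfired P q Q P↭ = m+n≡0⇒m≡0 (count P q) (suc-injective (begin
      suc (count P q + count Q q)            ≡⟨ +-suc (count P q) (count Q q) ⟨
      count P q + (1 + count Q q)            ≡⟨ cong (λ b → count P q + (𝟙 b + count Q q)) (dec-true (q ≟ q) refl) ⟨
      count P q + count (q ∷ Q) q            ≡⟨ sum-map-++ _ P (q ∷ Q) ⟨
      count (P ++ q ∷ Q) q                   ≡⟨ sum-map-↭ _ P↭ ⟩
      sumList (map is-q (allFin n))          ≡⟨ sum-map-allFin is-q ⟩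
      sum is-q                               ≡⟨ sum-single (λ _ → 1) q ⟩
      1                                      ∎))
      where
      open ≡-Reasoning
      is-q : Fin n → ℕ
      is-q u = 𝟙 (does (u ≟ q))

    lower-neighbours-fired : ∀ P q Q → P ++ q ∷ Q ↭ allFin n → All (λ u → t q ≤ t u) Q →
                             indeg G t q ≤ received G P q
    lower-neighbours-fired P q Q P↭ q≤Q = begin
      indeg G t q                                     ≡⟨ sum-map-allFin (λ u → arc G t u q) ⟨
      sumList (map (λ u → arc G t u q) (allFin n))    ≡⟨ sum-map-↭ _ P↭ ⟨
      sumList (map (λ u → arc G t u q) (P ++ q ∷ Q))  ≡⟨ sum-map-++ _ P (q ∷ Q) ⟩
      Σ-arc P + (arc G t q q + Σ-arc Q)               ≡⟨ cong (λ x → Σ-arc P + (x + Σ-arc Q)) (arc-self {G = G} loopless t q) ⟩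
      Σ-arc P + Σ-arc Q                               ≡⟨ cong (Σ-arc P +_) (sum-map-zero (All.map no-arc-from-above q≤Q)) ⟩
      Σ-arc P + 0                                     ≡⟨ +-identityʳ _ ⟩
      Σ-arc P                                         ≤⟨ sum-map-mono-≤ P (λ u → arc≤𝟙 {G = G} t u q) ⟩
      received G P q                                  ∎
      where
      open ≤-Reasoning
      Σ-arc : List (Fin n) → ℕ
      Σ-arc L = sumList (map (λ u → arc G t u q) L)
      no-arc-from-above : ∀ {u} → t q ≤ t u → arc G t u q ≡ 0
      no-arc-from-above {u} q≤u with t u <ᵇ t q | <ᵇ-reflects-< (t u) (t q)
      ... | true  | ofʸ u<q = contradiction q≤u (<⇒≱ u<q)
      ... | false | _       = refl

  run-in-label-order : ∀ P Q {d} → P ++ Q ↭ allFin n → AllPairs (λ u w → t u ≤ t w) Q →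
                       FiredFrom G c P d → LegalRun G d Q c
  run-in-label-order P [] P↭ _ inv =
    done (λ j → sym (firedFrom-allFin symmetric {c} {P} inv (subst (_↭ allFin n) (++-identityʳ P) P↭) j))
  run-in-label-order P (q ∷ Q) {d} P↭ (q≤Q ∷ sorted) inv =
    fires q legal (λ _ → refl)
      (run-in-label-order (P ++ [ q ]) Q (subst (_↭ allFin n) (sym (++-assoc P [ q ] Q)) P↭) sorted
        (firedFrom-∷ʳ loopless {c} {P} {d} inv legal))
    where
    legal : deg G q ≤ d q
    legal = firedFrom-legal symmetric {t} {c} {P} {d} proper inv
              (unfired P q Q P↭) (out≤c q) (lower-neighbours-fired P q Q P↭ q≤Q)

  open Sort (On.decTotalOrder ≤-decTotalOrder t) using (sort; sort-↭; sort-↗)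

  fire-in-label-order : 1 ≤ n → SelfReachable G c
  fire-in-label-order (s≤s _) with sort (allFin n) | sort-↭ (allFin n) | sort-↗ (allFin n)
  ... | []    | []↭ | _      = contradiction (↭-sym []↭) ¬x∷xs↭[]
  ... | q ∷ Q | q∷Q↭ | sorted =
    run⇒closure (run-in-label-order [] (q ∷ Q) q∷Q↭ (Linked⇒AllPairs ≤-trans sorted) (λ _ → refl))

outDominated⇒selfReachable : ∀ {n} {G : Graph n} → Symmetric G → Loopless G → 1 ≤ n →
                             ∀ {c} → OutDominated G c → SelfReachable G c
outDominated⇒selfReachable symmetric loopless n≥1 (t , proper , out≤c) =
  fire-in-label-order symmetric loopless proper out≤c n≥1

occurs : Fin n → List (Fin n) → Bool
occurs w []      = false
occurs w (u ∷ L) = does (w ≟ u) ∨ occurs w L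

-- The position of the last occurrence of w in L, and 0 if w does not occur.
lastIndex : List (Fin n) → Fin n → ℕ
lastIndex []      w = 0
lastIndex (u ∷ L) w = if occurs w L then suc (lastIndex L w) else 0

≟-∨false : ∀ {w u : Fin n} → does (w ≟ u) ∨ false ≡ true → w ≡ u
≟-∨false {w = w} {u} w≟u with w ≟ u
... | yes w≡u = w≡u
... | no _    = contradiction w≟u λ ()

lastIndex-injective : ∀ L {u w : Fin n} → occurs u L ≡ true → occurs w L ≡ true →
                      lastIndex L u ≡ lastIndex L w → u ≡ w
lastIndex-injective (f ∷ L) {u} {w} occ-u occ-w same with occurs u L in u∈L | occurs w L in w∈L
... | true  | true  = lastIndex-injective L u∈L w∈L (suc-injective same)
... | true  | false = contradiction same λ ()
... | false | true  = contradiction same λ ()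
... | false | false = trans (≟-∨false occ-u) (sym (≟-∨false occ-w))

if-∨-≤ : ∀ a b x → (if a ∨ b then x else 0) ≤ (if a then x else 0) + (if b then x else 0)
if-∨-≤ true  b     x = m≤m+n x _
if-∨-≤ false true  x = ≤-refl
if-∨-≤ false false x = z≤n

chips-grow-while-unfired : ∀ {n} {G : Graph n} {d L d'} → LegalRun G d L d' → ∀ w → occurs w L ≡ false →
  d w + sum (λ u → if occurs u L then 𝟙 (G u w) else 0) ≤ d' w
chips-grow-while-unfired {n} (done d'≗d) w _ =
  ≤-reflexive (trans (cong (_ +_) (sum-replicate-zero n)) (trans (+-identityʳ _) (sym (d'≗d w))))
chips-grow-while-unfired {n} {G} {d} {f ∷ L} {d'} (fires {d₁ = d₁} f _ d₁≗ run) w unfired = begin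
  d w + sum (λ u → if occurs u (f ∷ L) then 𝟙 (G u w) else 0)
    ≤⟨ +-monoʳ-≤ (d w) (sum-mono-≤ (λ u → if-∨-≤ (does (u ≟ f)) (occurs u L) (𝟙 (G u w)))) ⟩
  d w + sum (λ u → (if does (u ≟ f) then 𝟙 (G u w) else 0) + later u)
    ≡⟨ cong (d w +_) (∑-distrib-+ (λ u → if does (u ≟ f) then 𝟙 (G u w) else 0) later) ⟩
  d w + (sum (λ u → if does (u ≟ f) then 𝟙 (G u w) else 0) + sum later)
    ≡⟨ cong (λ x → d w + (x + sum later)) (sum-single (λ u → 𝟙 (G u w)) f) ⟩
  d w + (𝟙 (G f w) + sum later)   ≡⟨ +-assoc (d w) _ _ ⟨
  (d w + 𝟙 (G f w)) + sum later   ≡⟨ cong (_+ sum later) (trans (d₁≗ w) (fire-other G d f≢w)) ⟨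
  d₁ w + sum later                ≤⟨ chips-grow-while-unfired run w (∨-conicalʳ _ _ unfired) ⟩
  d' w                            ∎
  where
  open ≤-Reasoning
  later : Fin _ → ℕ
  later u = if occurs u L then 𝟙 (G u w) else 0
  f≢w : f ≢ w
  f≢w refl = contradiction (trans (sym (dec-true (f ≟ f) refl)) (∨-conicalˡ _ _ unfired)) λ ()

-- Each neighbour of w whose last firing comes after that of w has since sent w a chip.
later-neighbours≤chips : ∀ {n} {G : Graph n} → Symmetric G → ∀ {d L d'} → LegalRun G d L d' →
  ∀ w → occurs w L ≡ true → sum (λ u → if occurs u L then arc G (lastIndex L) w u else 0) ≤ d' w
later-neighbours≤chips symmetric (done _) w ()
later-neighbours≤chips {G = G} symmetric {L = f ∷ L} {d'} (fires {d₁ = d₁} f _ _ run) w _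
  with occurs w L in w∈L
... | true  = ≤-trans (sum-mono-≤ still-later) (later-neighbours≤chips symmetric run w w∈L)
  where
  still-later : ∀ u → (if does (u ≟ f) ∨ occurs u L
                         then (if suc (lastIndex L w) <ᵇ lastIndex (f ∷ L) u then 𝟙 (G w u) else 0) else 0)
                      ≤ (if occurs u L then arc G (lastIndex L) w u else 0)
  still-later u with does (u ≟ f) | occurs u L
  ... | true  | true  = ≤-refl
  ... | false | true  = ≤-refl
  ... | true  | false = z≤n
  ... | false | false = z≤n
... | false = begin
  sum (λ u → if does (u ≟ f) ∨ occurs u L then (if 0 <ᵇ lastIndex (f ∷ L) u then 𝟙 (G w u) else 0) else 0)
    ≤⟨ sum-mono-≤ fired-later ⟩
  sum (λ u → if occurs u L then 𝟙 (G u w) else 0)          ≤⟨ m≤n+m _ (d₁ w) ⟩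
  d₁ w + sum (λ u → if occurs u L then 𝟙 (G u w) else 0)   ≤⟨ chips-grow-while-unfired run w w∈L ⟩
  d' w ∎
  where
  open ≤-Reasoning
  fired-later : ∀ u → (if does (u ≟ f) ∨ occurs u L then (if 0 <ᵇ lastIndex (f ∷ L) u then 𝟙 (G w u) else 0) else 0)
                      ≤ (if occurs u L then 𝟙 (G u w) else 0)
  fired-later u with does (u ≟ f) | occurs u L
  ... | true  | true  = ≤-reflexive (cong 𝟙 (symmetric w u))
  ... | false | true  = ≤-reflexive (cong 𝟙 (symmetric w u))
  ... | true  | false = z≤n
  ... | false | false = z≤n

selfReachable⇒outDominated : ∀ {n} {G : Graph n} → Symmetric G → Loopless G → (∀ i j → Walk G i j) →
                             ∀ {c} → SelfReachable G c → OutDominated G c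
selfReachable⇒outDominated {G = G} symmetric loopless connected {c} c↝c with closure⇒run c↝c
... | f , L , run = lastIndex (f ∷ L) , proper , out≤c
  where
  F = f ∷ L
  -- An unfired neighbour of a fired vertex would end with more chips than it started with.
  spread : ∀ {u w} → occurs u F ≡ true → G u w ≡ true → occurs w F ≡ true
  spread {u} {w} u∈F uw with occurs w F in w∈F
  ... | true  = refl
  ... | false = contradiction (m<m+n (c w) gain) (≤⇒≯ (chips-grow-while-unfired run w w∈F))
    where
    gain : 1 ≤ sum (λ x → if occurs x F then 𝟙 (G x w) else 0)
    gain = ≤-trans (≤-reflexive (sym (cong₂ (λ a b → if a then 𝟙 b else 0) u∈F uw))) (term≤sum _ u)
  reach : ∀ {i j} → Walk G i j → occurs i F ≡ true → occurs j F ≡ true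
  reach here i∈F = i∈F
  reach (step ij walk) i∈F = reach walk (spread i∈F ij)
  fired : ∀ w → occurs w F ≡ true
  fired w = reach (connected f w) (cong (_∨ occurs f L) (dec-true (f ≟ f) refl))
  proper : Proper G (lastIndex F)
  proper u w uw same with lastIndex-injective F (fired u) (fired w) same
  ... | refl = contradiction (trans (sym uw) (loopless u)) λ ()
  out≤c : ∀ w → outdeg G (lastIndex F) w ≤ c w
  out≤c w = ≤-trans (≤-reflexive (sum-cong-≗ all-fired)) (later-neighbours≤chips symmetric run w (fired w))
    where
    all-fired : ∀ u → arc G (lastIndex F) w u ≡ (if occurs u F then arc G (lastIndex F) w u else 0)
    all-fired u = cong (λ b → if b then arc G (lastIndex F) w u else 0) (sym (fired u))

-- Near-minimal decomposition

minusE-self : ∀ (c : Config n) j → minusE c j j ≡ c j ∸ 1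
minusE-self c j rewrite dec-true (j ≟ j) refl = refl

minusE-other : ∀ (c : Config n) {j w} → j ≢ w → minusE c j w ≡ c w
minusE-other c {j} {w} j≢w rewrite dec-false (j ≟ w) j≢w = refl

module Decomposition {n} {T : Graph n} (tree : IsTree T) (n≥1 : 1 ≤ n) {k : ℕ} (k≥1 : 1 ≤ k) where
  open IsTree tree

  ν : (Fin n → ℕ) → Fin n → Config n
  ν t v w = outdeg T t w + (if does (w ≟ v) then k else 0)

  NearMinimal : Config n → Set
  NearMinimal x = NearMinSelfReachable T x × chips x ≡ (n ∸ 1) + k

  ν-self : ∀ t v → ν t v v ≡ outdeg T t v + k
  ν-self t v = cong (λ b → outdeg T t v + (if b then k else 0)) (dec-true (v ≟ v) refl)

  ν-other : ∀ t {v w} → w ≢ v → ν t v w ≡ outdeg T t w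
  ν-other t {v} {w} w≢v =
    trans (cong (λ b → outdeg T t w + (if b then k else 0)) (dec-false (w ≟ v) w≢v)) (+-identityʳ _)

  chips-ν : ∀ {t} → Proper T t → ∀ v → chips (ν t v) ≡ (n ∸ 1) + k
  chips-ν {t} proper v = begin
    chips (ν t v)                                                   ≡⟨ chips≡sum (ν t v) ⟩
    sum (ν t v)                                                     ≡⟨ ∑-distrib-+ (outdeg T t) _ ⟩
    sum (outdeg T t) + sum (λ w → if does (w ≟ v) then k else 0)
      ≡⟨ cong₂ _+_ (sum-outdeg-tree tree proper) (sum-single (λ _ → k) v) ⟩
    (n ∸ 1) + k                                                     ∎
    where open ≡-Reasoning

  ∑-weighted-ν : ∀ (m : Fin n → ℕ) t w → sum (λ u → m u * ν t u w) ≡ sum m * outdeg T t w + m w * k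
  ∑-weighted-ν m t w = begin
    sum (λ u → m u * ν t u w)                        ≡⟨ sum-cong-≗ (λ u → *-distribˡ-+ (m u) _ _) ⟩
    sum (λ u → m u * O + m u * (if does (w ≟ u) then k else 0))
                                                     ≡⟨ ∑-distrib-+ (λ u → m u * O) _ ⟩
    sum (λ u → m u * O) + sum (λ u → m u * (if does (w ≟ u) then k else 0))
                                                     ≡⟨ cong₂ _+_ (*-distribʳ-sum O m) (sum-cong-≗ pick) ⟨
    sum m * O + sum (λ u → if does (u ≟ w) then m u * k else 0)
                                                     ≡⟨ cong (sum m * O +_) (sum-single (λ u → m u * k) w) ⟩
    sum m * O + m w * k                              ∎
    where
    open ≡-Reasoning
    O = outdeg T t w
    pick : ∀ u → (if does (u ≟ w) then m u * k else 0) ≡ m u * (if does (w ≟ u) then k else 0)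
    pick u rewrite does-≟-comm w u with does (u ≟ w)
    ... | true  = refl
    ... | false = sym (*-zeroʳ (m u))

  minus-elsewhere-not-selfReachable : ∀ {t v j} → Proper T t → IsLocalMin T t v → j ≢ v → 1 ≤ ν t v j →
                                      ¬ SelfReachable T (minusE (ν t v) j)
  minus-elsewhere-not-selfReachable {t} {v} {j} proper min j≢v occupied sr
    with selfReachable⇒outDominated symmetric irreflexive connected sr
  ... | t' , proper' , out'≤ = <-irrefl refl (begin-strict
    n ∸ 1                                             ≡⟨ sum-outdeg-tree tree proper' ⟨
    sum (outdeg T t')                                 <⟨ m<m+n _ (s≤s z≤n) ⟩
    sum (outdeg T t') + 1                             ≡⟨ cong (sum (outdeg T t') +_) (sum-single (λ _ → 1) j) ⟨
    sum (outdeg T t') + sum (λ w → 𝟙 (does (w ≟ j)))  ≡⟨ ∑-distrib-+ (outdeg T t') _ ⟨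
    sum (λ w → outdeg T t' w + 𝟙 (does (w ≟ j)))      ≤⟨ sum-mono-≤ pointwise ⟩
    sum (outdeg T t)                                  ≡⟨ sum-outdeg-tree tree proper ⟩
    n ∸ 1                                             ∎)
    where
    open ≤-Reasoning
    pointwise : ∀ w → outdeg T t' w + 𝟙 (does (w ≟ j)) ≤ outdeg T t w
    pointwise w with w ≟ j
    ... | yes refl = begin
      outdeg T t' j + 1              ≤⟨ +-monoˡ-≤ 1 (≤-trans (out'≤ j) (≤-reflexive (minusE-self (ν t v) j))) ⟩
      (ν t v j ∸ 1) + 1              ≡⟨ m∸n+n≡m occupied ⟩
      ν t v j                        ≡⟨ ν-other t j≢v ⟩
      outdeg T t j                   ∎
    ... | no w≢j with w ≟ v
    ...   | yes refl = begin
      outdeg T t' v + 0              ≡⟨ +-identityʳ _ ⟩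
      outdeg T t' v                  ≤⟨ outdeg≤deg {G = T} t' v ⟩
      deg T v                        ≡⟨ outdeg-localMin {G = T} min ⟨
      outdeg T t v                   ∎
    ...   | no w≢v   = begin
      outdeg T t' w + 0              ≡⟨ +-identityʳ _ ⟩
      outdeg T t' w                  ≤⟨ out'≤ w ⟩
      minusE (ν t v) j w             ≡⟨ minusE-other (ν t v) (λ j≡w → w≢j (sym j≡w)) ⟩
      ν t v w                        ≡⟨ ν-other t w≢v ⟩
      outdeg T t w                   ∎

  ν-nearMinimal : ∀ {t v} → Proper T t → IsLocalMin T t v → NearMinimal (ν t v)
  ν-nearMinimal {t} {v} proper min =
    (selfReachable , not-minimal , v , (occupied , minus-self-selfReachable) , only-v) , chips-ν proper v
    where
    selfReachable : SelfReachable T (ν t v)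
    selfReachable = outDominated⇒selfReachable symmetric irreflexive n≥1 (t , proper , λ w → m≤m+n _ _)
    not-minimal : ¬ MinSelfReachable T (ν t v)
    not-minimal (_ , minimal) = <-irrefl (trans (sym minimal) (chips-ν proper v)) (m<m+n (n ∸ 1) k≥1)
    occupied : 1 ≤ ν t v v
    occupied = ≤-trans k≥1 (≤-trans (m≤n+m k _) (≤-reflexive (sym (ν-self t v))))
    dominated : ∀ w → outdeg T t w ≤ minusE (ν t v) v w
    dominated w = by-cases (v ≟ w)
      where
      open ≤-Reasoning
      by-cases : Dec (v ≡ w) → outdeg T t w ≤ minusE (ν t v) v w
      by-cases (yes refl) = begin
        outdeg T t v                    ≤⟨ m≤m+n _ _ ⟩
        outdeg T t v + (k ∸ 1)          ≡⟨ +-∸-assoc (outdeg T t v) k≥1 ⟨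
        (outdeg T t v + k) ∸ 1          ≡⟨ cong (_∸ 1) (ν-self t v) ⟨
        ν t v v ∸ 1                     ≡⟨ minusE-self (ν t v) v ⟨
        minusE (ν t v) v v              ∎
      by-cases (no v≢w) = ≤-trans (m≤m+n _ _) (≤-reflexive (sym (minusE-other (ν t v) v≢w)))
    minus-self-selfReachable : SelfReachable T (minusE (ν t v) v)
    minus-self-selfReachable = outDominated⇒selfReachable symmetric irreflexive n≥1 (t , proper , dominated)
    only-v : ∀ j → MinusSR T (ν t v) j → j ≡ v
    only-v j (occupied-j , sr) = decidable-stable (j ≟ v) λ j≢v →
      minus-elsewhere-not-selfReachable proper min j≢v occupied-j sr

  ν-lowering : ∀ {t} → Proper T t → ∀ v w →
    (k + indeg T t v) * ν t v w ≡ k * ν (lower t v) v w + sum (λ u → arc T t u v * ν t u w)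
  ν-lowering {t} proper v w = by-cases (w ≟ v)
    where
    open ≡-Reasoning
    I = indeg T t v
    lowered-self : outdeg T (lower t v) v ≡ outdeg T t v + I
    lowered-self = trans (outdeg-localMin {G = T} (lower-localMin {G = T} irreflexive t v))
                         (deg≡outdeg+indeg symmetric proper v)
    regroup-self : ∀ k I O → (k + I) * (O + k) ≡ k * ((O + I) + k) + (I * O + 0 * k)
    regroup-self = solve-∀
    regroup-other : ∀ k I L a → (k + I) * (L + a) ≡ k * L + (I * (L + a) + a * k)
    regroup-other = solve-∀
    lower-weighted : ∀ w → sum (λ u → arc T t u v * ν t u w) ≡ I * outdeg T t w + arc T t w v * k
    lower-weighted = ∑-weighted-ν (λ u → arc T t u v) t
    by-cases : Dec (w ≡ v) → (k + I) * ν t v w ≡ k * ν (lower t v) v w + sum (λ u → arc T t u v * ν t u w)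
    by-cases (yes refl) = begin
      (k + I) * ν t v v                           ≡⟨ cong ((k + I) *_) (ν-self t v) ⟩
      (k + I) * (O + k)                           ≡⟨ regroup-self k I O ⟩
      k * ((O + I) + k) + (I * O + 0 * k)         ≡⟨ cong₂ (λ x y → k * (x + k) + (I * O + y * k)) lowered-self no-loop ⟨
      k * (outdeg T (lower t v) v + k) + (I * O + arc T t v v * k)
                                                  ≡⟨ cong₂ _+_ (cong (k *_) (ν-self (lower t v) v)) (lower-weighted v) ⟨
      k * ν (lower t v) v v + sum (λ u → arc T t u v * ν t u v) ∎
      where
      O = outdeg T t v
      no-loop = arc-self {G = T} irreflexive t v
    by-cases (no w≢v) = begin
      (k + I) * ν t v w                           ≡⟨ cong ((k + I) *_) (trans (ν-other t w≢v) lowered-other) ⟩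
      (k + I) * (L + a)                           ≡⟨ regroup-other k I L a ⟩
      k * L + (I * (L + a) + a * k)               ≡⟨ cong (λ x → k * L + (I * x + a * k)) lowered-other ⟨
      k * L + (I * outdeg T t w + a * k)          ≡⟨ cong₂ _+_ (cong (k *_) (ν-other (lower t v) w≢v)) (lower-weighted w) ⟨
      k * ν (lower t v) v w + sum (λ u → arc T t u v * ν t u w) ∎
      where
      L = outdeg T (lower t v) w
      a = arc T t w v
      lowered-other = outdeg-lower-other {G = T} t w≢v

  ν-convexCombination : ∀ {t} → Proper T t → ∀ v → ConvexCombinationOf NearMinimal (ν t v)
  ν-convexCombination {t} proper = WF.All.wfRec (On.wellFounded t <-wellFounded) _ Goal decompose
    where
    Goal : Fin n → Set
    Goal v = ConvexCombinationOf NearMinimal (ν t v)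
    decompose : ∀ v → (∀ {u} → t u < t v → Goal u) → Goal v
    decompose v below =
      convex-average NearMinimal m x pieces (≤-trans k≥1 (m≤m+n k _)) (ν-lowering proper v)
      where
      m : Fin (suc n) → ℕ
      m zero    = k
      m (suc u) = arc T t u v
      x : Fin (suc n) → Config n
      x zero    = ν (lower t v) v
      x (suc u) = ν t u
      pieces : ∀ a → 0 < m a → ConvexCombinationOf NearMinimal (x a)
      pieces zero    _     = convex-single NearMinimal
        (ν-nearMinimal (lower-proper {G = T} irreflexive proper v) (lower-localMin {G = T} irreflexive t v))
      pieces (suc u) arc>0 = below (arc>0⇒< {G = T} t arc>0)

  selfReachable⇒convexCombination : ∀ {s} → SelfReachable T s → chips s ≡ (n ∸ 1) + k →
                                    ConvexCombinationOf NearMinimal s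
  selfReachable⇒convexCombination {s} sr chips-s
    with selfReachable⇒outDominated symmetric irreflexive connected sr
  ... | t , proper , out≤s =
    convex-average NearMinimal m (ν t) (λ v _ → ν-convexCombination proper v)
      (≤-trans k≥1 (≤-reflexive (sym Σm≡k))) average
    where
    open ≡-Reasoning
    m : Fin n → ℕ
    m w = s w ∸ outdeg T t w
    Σm≡k : sum m ≡ k
    Σm≡k = +-cancelˡ-≡ (n ∸ 1) (sum m) k (begin
      (n ∸ 1) + sum m                   ≡⟨ cong (_+ sum m) (sum-outdeg-tree tree proper) ⟨
      sum (outdeg T t) + sum m          ≡⟨ ∑-distrib-+ (outdeg T t) m ⟨
      sum (λ w → outdeg T t w + m w)    ≡⟨ sum-cong-≗ (λ w → m+[n∸m]≡n (out≤s w)) ⟩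
      sum s                             ≡⟨ chips≡sum s ⟨
      chips s                           ≡⟨ chips-s ⟩
      (n ∸ 1) + k                       ∎)
    regroup : ∀ k O x → k * (O + x) ≡ k * O + x * k
    regroup = solve-∀
    average : ∀ w → sum m * s w ≡ sum (λ v → m v * ν t v w)
    average w = begin
      sum m * s w                       ≡⟨ cong₂ _*_ Σm≡k (sym (m+[n∸m]≡n (out≤s w))) ⟩
      k * (outdeg T t w + m w)          ≡⟨ regroup k (outdeg T t w) (m w) ⟩
      k * outdeg T t w + m w * k        ≡⟨ cong (λ x → x * outdeg T t w + m w * k) Σm≡k ⟨
      sum m * outdeg T t w + m w * k    ≡⟨ ∑-weighted-ν m t w ⟨
      sum (λ v → m v * ν t v w)         ∎

lemma5p10 : (n : ℕ) → 1 ≤ n → (T : Graph n) → IsTree T → (ℓ : ℕ) → n ≤ ℓ →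
    (s : Config n) → SelfReachable T s → chips s ≡ ℓ →
    ConvexCombinationOf (λ ν → NearMinSelfReachable T ν × chips ν ≡ ℓ) s
lemma5p10 (suc n-1) n≥1 T tree ℓ n-1<ℓ s sr chips-s =
  subst (λ ℓ → ConvexCombinationOf (λ ν → NearMinSelfReachable T ν × chips ν ≡ ℓ) s) ℓ-split
    (selfReachable⇒convexCombination sr (trans chips-s (sym ℓ-split)))
  where
  open Decomposition tree n≥1 (m<n⇒0<n∸m n-1<ℓ)
  ℓ-split : n-1 + (ℓ ∸ n-1) ≡ ℓ
  ℓ-split = m+[n∸m]≡n (<⇒≤ n-1<ℓ)
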